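{- For every positive integer $\alpha$, \[ \sum_{n\ge0}\ \sum_{\sigma\in\mathcal{S}^{(\alpha)}[n]}y^{|\underline\sigma|}q^{\mathsf{inv}(\underline\sigma)+\mathsf{inv}(\underline{\underline\sigma})}\frac{t^n}{n!_q} =\sum_{n\ge 0}L^{(\alpha)}_n(0;y|q)\frac{t^n}{n!_q}. \]
   Context: Notation: $[n]_q=\frac{1-q^n}{1-q}$, $n!_q=\prod_{i=1}^n[i]_q$. For an integer $\alpha$, $L^{(\alpha)}_n(x;y;q)$ is defined by $L^{(\alpha)}_{ -1}=0$, $L^{(\alpha)}_0=1$ and, for $n\ge 0$, $L^{(\alpha)}_{n+1}(x;y;q)=\bigl(x-(y[n+\alpha+1]_q+[n]_q)\bigr)L^{(\alpha)}_n(x;y;q)-y[n]_q[n+\alpha]_q\,L^{(\alpha)}_{n-1}(x;y;q)$, and $L^{(\alpha)}_n(x;y|q):=(-1)^nL^{(\alpha)}_n(-x;y;q)$. For a word $w=w_1\cdots w_m$, $\mathsf{inv}(w)=\#\{(i,j):i<j,\ w_i>w_j\}$. $\mathcal{S}^{(\alpha)}[n]$ is the set of permutations $\sigma$ of $\{1,\dots,n\}$ in which each cycle carries a color in $\{0,1,\dots,\alpha\}$. Let $A_i$ be the union of the cycles of color $i$, $\sigma_i$ the restriction of $\sigma$ to $A_i$, and, if $A_i=\{a_1<\dots<a_m\}$, $\hat\sigma_i=\sigma_i(a_1)\cdots\sigma_i(a_m)$. Then $\underline\sigma=\hat\sigma_0\hat\sigma_1\cdots\hat\sigma_\alpha$ (so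 $|\underline\sigma|=n$) and $\underline{\underline\sigma}=0^{|A_0|}\,1\,0^{|A_1|}\,1\cdots1\,0^{|A_\alpha|}$ (a $0/1$ word with $\alpha$ ones). -}

module Defs where

open import Level using (Level)
open import Algebra.Bundles using (CommutativeRing)
open import Data.Nat as ℕ using (ℕ; zero; suc; _<ᵇ_)
open import Data.Fin as Fin using (Fin; toℕ)
open import Data.Fin.Properties using (_≟_)
open import Data.Vec as Vec using (Vec; lookup)
open import Data.List as List using (List; []; _∷_; _++_; length; replicate; concat; map; allFin; filter; filterᵇ; cartesianProductWith)
open import Data.List.Relation.Unary.All using (All; all?)
import Data.List.Relation.Unary.Unique.DecPropositional as UniqueDec
open import Relation.Binary.PropositionalEquality using (_≡_)
open import Relation.Nullary.Decidable using (Dec)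

allVecs : {A : Set} → List A → (n : ℕ) → List (Vec A n)
allVecs xs zero    = Vec.[] ∷ []
allVecs xs (suc n) = cartesianProductWith Vec._∷_ xs (allVecs xs n)

-- A permutation of {1..n} (encoded as Fin n) in one-line notation:
-- σ(1) σ(2) … σ(n), i.e. a vector whose entries are pairwise distinct.
IsPerm : {n : ℕ} → Vec (Fin n) n → Set
IsPerm {n} σ = UniqueDec.Unique (_≟_ {n}) (Vec.toList σ)

isPerm? : {n : ℕ} → (σ : Vec (Fin n) n) → Dec (IsPerm σ)
isPerm? {n} σ = UniqueDec.unique? (_≟_ {n}) (Vec.toList σ)

perms : (n : ℕ) → List (Vec (Fin n) n)
perms n = filter isPerm? (allVecs (allFin n) n)

-- A coloring of the cycles of σ by colours {0..α} is the same as a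
-- colouring c of the elements that is constant on cycles, i.e.
-- c (σ i) ≡ c i for every i.
IsCycleColouring : {n : ℕ} (α : ℕ) → Vec (Fin n) n → Vec (Fin (suc α)) n → Set
IsCycleColouring {n} α σ c = All (λ i → lookup c (lookup σ i) ≡ lookup c i) (allFin n)

isCycleColouring? : {n : ℕ} (α : ℕ) (σ : Vec (Fin n) n) (c : Vec (Fin (suc α)) n)
                  → Dec (IsCycleColouring α σ c)
isCycleColouring? α σ c = all? (λ i → lookup c (lookup σ i) ≟ lookup c i) _

ColPerm : (α n : ℕ) → Set
ColPerm α n = Vec (Fin n) n × Vec (Fin (suc α)) n
  where open import Data.Product using (_×_)

open import Data.Product using (_×_; _,_; proj₁; proj₂)

colPerms : (α n : ℕ) → List (Vec (Fin n) n × Vec (Fin (suc α)) n)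
colPerms α n =
  concat (map (λ σ → map (σ ,_) (filter (isCycleColouring? α σ) (allVecs (allFin (suc α)) n)))
              (perms n))

block : {α n : ℕ} → Vec (Fin (suc α)) n → Fin (suc α) → List (Fin n)
block {n = n} c k = filter (λ i → lookup c i ≟ k) (allFin n)

-- σ̂_k = σ(a₁) ⋯ σ(a_m)  (values as natural numbers 1..n, shifted to 0..n-1)
hatσ : {α n : ℕ} → Vec (Fin n) n → Vec (Fin (suc α)) n → Fin (suc α) → List ℕ
hatσ σ c k = map (λ i → toℕ (lookup σ i)) (block c k)

underσ : {α n : ℕ} → Vec (Fin n) n → Vec (Fin (suc α)) n → List ℕ
underσ {α} σ c = concat (map (hatσ σ c) (allFin (suc α)))

underunderσ : {α n : ℕ} → Vec (Fin (suc α)) n → List ℕ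
underunderσ {α} c =
  replicate (length (block c Fin.zero)) 0
  ++ concat (map (λ k → 1 ∷ replicate (length (block c (Fin.suc k))) 0) (allFin α))

inv : List ℕ → ℕ
inv []       = 0
inv (x ∷ w) = length (filterᵇ (λ z → z <ᵇ x) w) ℕ.+ inv w

-- Ring-valued quantities (identity of polynomials in y, q over ℤ is
-- expressed as an identity valid in every commutative ring)

module _ {c ℓ : Level} (R : CommutativeRing c ℓ) where
  open CommutativeRing R

  pow : Carrier → ℕ → Carrier
  pow a zero    = 1#
  pow a (suc n) = a * pow a n

  sumR : List Carrier → Carrier
  sumR = List.foldr _+_ 0#

  qint : Carrier → ℕ → Carrier
  qint q zero    = 0#
  qint q (suc n) = 1# + q * qint q n

  -- L^{(α)}_n(x;y;q), with L_{-1} = 0 and L_0 = 1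
  Lag : ℕ → Carrier → Carrier → Carrier → ℕ → Carrier
  Lag α x y q zero          = 1#
  Lag α x y q (suc zero)    =
    (x + - (y * qint q (0 ℕ.+ α ℕ.+ 1) + qint q 0)) * 1#
    + - (y * qint q 0 * qint q (0 ℕ.+ α) * 0#)
  Lag α x y q (suc (suc n)) =
    (x + - (y * qint q (suc n ℕ.+ α ℕ.+ 1) + qint q (suc n))) * Lag α x y q (suc n)
    + - (y * qint q (suc n) * qint q (suc n ℕ.+ α) * Lag α x y q n)

  -- L^{(α)}_n(x;y|q) = (-1)^n L^{(α)}_n(-x;y;q)
  LagBar : ℕ → Carrier → Carrier → Carrier → ℕ → Carrier
  LagBar α x y q n = pow (- 1#) n * Lag α (- x) y q n

  colPermSum : ℕ → Carrier → Carrier → ℕ → Carrier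
  colPermSum α y q n =
    sumR (map (λ p → pow y (length (underσ (proj₁ p) (proj₂ p)))
                     * pow q (inv (underσ (proj₁ p) (proj₂ p)) ℕ.+ inv (underunderσ {α} (proj₂ p))))
              (colPerms α n))

module Submission where

open import Defs
open import Level using (Level)
open import Algebra.Bundles using (CommutativeRing)
open import Data.Nat using (ℕ; _≤_)

-- A coloured permutation (σ , c) ∈ 𝒮^{(α)}[n] is the same thing as a pair
-- (w , m): the word w = σ̲, an arbitrary arrangement of {0,…,n-1}, and the
-- composition m = (|A₀|,…,|A_α|) of n, which alone determines σ̲̲.  Indeed
-- m fixes the colour of every letter of w, and σ sends the elements of
-- A₀, A₁, … (listed increasingly) to the letters of w in order.  Hence
--   colPermSum = y^n · (Σ_w q^{inv w}) · (Σ_m q^{inv σ̲̲(m)}),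
-- and the theorem follows from three evaluations:
--   (Mahonian)      Σ_w q^{inv w} = n!_q, by inserting the largest letter;
--   (compositions)  n!_q · Σ_m q^{inv σ̲̲(m)} = ∏_{k=1}^{n} [k+α]_q,
--                   by induction on α (peel off the first part of m);
--   (Laguerre)      L̄^{(α)}_n(0;y|q) = y^n ∏_{k=1}^{n} [k+α]_q, by the
--                   three-term recurrence.

open import Data.Nat as ℕ using (zero; suc; _<_; z≤n; s≤s; _∸_; _<ᵇ_)
import Data.Nat.Properties as ℕP
open import Data.Bool using (T; true; false)
open import Data.Fin as Fin using (Fin; toℕ; fromℕ; inject₁)
import Data.Fin.Properties as FP
open import Data.Vec as Vec using (Vec; []; _∷_; lookup)
import Data.Vec.Properties as VP
open import Data.List as List
  using (List; []; _∷_; _++_; length; map; concat; concatMap; filter; filterᵇ;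
         replicate; allFin; downFrom; zip; cartesianProduct; cartesianProductWith)
import Data.List.Properties as LP
open import Data.List.Relation.Unary.All as All using (All; []; _∷_)
open import Data.List.Relation.Unary.Any using (here; there)
open import Data.List.Relation.Unary.AllPairs using ([]; _∷_)
open import Data.List.Relation.Unary.Unique.Propositional using (Unique)
import Data.List.Relation.Unary.Unique.Propositional.Properties as UP
import Data.List.Relation.Unary.Unique.DecPropositional as UniqueDec
open import Data.List.Membership.Propositional using (_∈_; _∉_; find; lose)
import Data.List.Membership.Propositional.Properties as MP
import Data.List.Membership.DecPropositional as DecMembership
open import Data.List.Membership.Propositional.Properties.WithK using (unique∧set⇒bag)
open import Data.List.Relation.Binary.BagAndSetEquality using (∼bag⇒↭)
open import Data.List.Relation.Binary.Permutation.Propositional using (_↭_; ↭⇒↭ₛ′)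
import Data.List.Relation.Binary.Permutation.Propositional.Properties as PermP
import Data.List.Relation.Binary.Permutation.Setoid.Properties as PermS
open import Data.List.Relation.Binary.Disjoint.Propositional using (Disjoint)
open import Data.Product using (∃; _×_; _,_; proj₁; proj₂)
open import Data.Sum using (_⊎_; inj₁; inj₂)
open import Data.Empty using (⊥-elim)
open import Function.Bundles using (mk⇔)
open import Relation.Binary.Definitions using (DecidableEquality)
open import Relation.Binary.PropositionalEquality
  using (_≡_; refl; sym; trans; cong; cong₂; subst; subst₂; module ≡-Reasoning)
open import Relation.Nullary using (¬_; yes; no)
import Algebra.Solver.Ring.NaturalCoefficients.Default as NatCoeffSolver

private variable
  A B : Set

map-unique : {f : A → B} {xs : List A} → Unique xs →
  (∀ {a b} → a ∈ xs → b ∈ xs → f a ≡ f b → a ≡ b) → Unique (map f xs)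
map-unique {xs = []} [] inj = []
map-unique {f = f} {xs = x ∷ xs} (x∉ ∷ u) inj =
  All.tabulate fx∉ ∷ map-unique u (λ a∈ b∈ → inj (there a∈) (there b∈))
  where
  fx∉ : ∀ {b} → b ∈ map f xs → ¬ f x ≡ b
  fx∉ b∈ refl with MP.∈-map⁻ f b∈
  ... | a , a∈ , fx≡fa = All.lookup x∉ a∈ (inj (here refl) (there a∈) fx≡fa)

unique-map⇒injective : {f : A → B} {xs : List A} {a b : A} → Unique (map f xs) →
  a ∈ xs → b ∈ xs → f a ≡ f b → a ≡ b
unique-map⇒injective {xs = x ∷ xs} u (here refl) (here refl) e = refl
unique-map⇒injective {f = f} (fx∉ ∷ u) (here refl) (there b∈) e = ⊥-elim (All.lookup fx∉ (MP.∈-map⁺ f b∈) e)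
unique-map⇒injective {f = f} (fx∉ ∷ u) (there a∈) (here refl) e = ⊥-elim (All.lookup fx∉ (MP.∈-map⁺ f a∈) (sym e))
unique-map⇒injective (_ ∷ u) (there a∈) (there b∈) e = unique-map⇒injective u a∈ b∈ e

map-≡⇒pointwise : {f g : A → B} {xs : List A} {a : A} → map f xs ≡ map g xs → a ∈ xs → f a ≡ g a
map-≡⇒pointwise {xs = x ∷ xs} e (here refl) = LP.∷-injectiveˡ e
map-≡⇒pointwise {xs = x ∷ xs} e (there a∈) = map-≡⇒pointwise (LP.∷-injectiveʳ e) a∈

map-cong-∈ : {f g : A → B} {xs : List A} → (∀ {a} → a ∈ xs → f a ≡ g a) → map f xs ≡ map g xs
map-cong-∈ h = LP.map-cong-local (All.tabulate h)

∈-concatMap⁺ : {f : A → List B} {xs : List A} {x : A} {y : B} → x ∈ xs → y ∈ f x → y ∈ concatMap f xs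
∈-concatMap⁺ {f = f} x∈ y∈ = MP.∈-concatMap⁺ f (lose x∈ y∈)

∈-concatMap⁻ : {f : A → List B} (xs : List A) {y : B} → y ∈ concatMap f xs → ∃ λ x → x ∈ xs × y ∈ f x
∈-concatMap⁻ {f = f} xs y∈ = find (MP.∈-concatMap⁻ f {xs = xs} y∈)

concatMap-unique : {f : A → List B} {xs : List A} (key : B → A) → Unique xs →
  (∀ x → Unique (f x)) → (∀ {x y} → y ∈ f x → key y ≡ x) → Unique (concatMap f xs)
concatMap-unique {xs = []} key u uf kf = []
concatMap-unique {f = f} {xs = x ∷ xs} key (x∉ ∷ u) uf kf =
  UP.++⁺ (uf x) (concatMap-unique key u uf kf) disjoint
  where
  disjoint : Disjoint (f x) (concatMap f xs)
  disjoint (y∈ , y∈rest) with ∈-concatMap⁻ xs y∈rest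
  ... | x' , x'∈ , y∈' = All.lookup x∉ x'∈ (trans (sym (kf y∈)) (kf y∈'))

insert : ℕ → A → List A → List A
insert zero x l = x ∷ l
insert (suc p) x [] = x ∷ []
insert (suc p) x (y ∷ l) = y ∷ insert p x l

insert-length : (p : ℕ) (x : A) (l : List A) → length (insert p x l) ≡ suc (length l)
insert-length zero x l = refl
insert-length (suc p) x [] = refl
insert-length (suc p) x (y ∷ l) = cong suc (insert-length p x l)

∈-insert⁻ : {a x : A} (p : ℕ) (l : List A) → a ∈ insert p x l → a ≡ x ⊎ a ∈ l
∈-insert⁻ zero l (here a≡x) = inj₁ a≡x
∈-insert⁻ zero l (there a∈) = inj₂ a∈
∈-insert⁻ (suc p) [] (here a≡x) = inj₁ a≡x
∈-insert⁻ (suc p) (y ∷ l) (here a≡y) = inj₂ (here a≡y)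
∈-insert⁻ (suc p) (y ∷ l) (there a∈) with ∈-insert⁻ p l a∈
... | inj₁ a≡x = inj₁ a≡x
... | inj₂ a∈l = inj₂ (there a∈l)

insert-unique : {x : A} (p : ℕ) {l : List A} → x ∉ l → Unique l → Unique (insert p x l)
insert-unique zero {l} x∉ u = All.tabulate (λ a∈ x≡a → x∉ (subst (_∈ l) (sym x≡a) a∈)) ∷ u
insert-unique (suc p) {[]} x∉ u = [] ∷ []
insert-unique {x = x} (suc p) {y ∷ l} x∉ (y∉ ∷ u) =
  All.tabulate y≢ ∷ insert-unique p (λ x∈ → x∉ (there x∈)) u
  where
  y≢ : ∀ {a} → a ∈ insert p x l → ¬ y ≡ a
  y≢ a∈ y≡a with ∈-insert⁻ p l a∈
  ... | inj₁ refl = x∉ (here (sym y≡a))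
  ... | inj₂ a∈l = All.lookup y∉ a∈l y≡a

map-insert : (f : A → B) (p : ℕ) (x : A) (l : List A) → map f (insert p x l) ≡ insert p (f x) (map f l)
map-insert f zero x l = refl
map-insert f (suc p) x [] = refl
map-insert f (suc p) x (y ∷ l) = cong (f y ∷_) (map-insert f p x l)

map-allFin-suc : {k : ℕ} (g : Fin (suc k) → A) → map g (allFin (suc k)) ≡ g Fin.zero ∷ map (λ i → g (Fin.suc i)) (allFin k)
map-allFin-suc g = cong (g Fin.zero ∷_) (trans (LP.map-tabulate Fin.suc g) (sym (LP.map-tabulate (λ i → i) (λ i → g (Fin.suc i)))))

module DecidableLists {A : Set} (_≟_ : DecidableEquality A) where

  remove : A → List A → List A
  remove x [] = []
  remove x (y ∷ ys) with x ≟ y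
  ... | yes _ = ys
  ... | no _ = y ∷ remove x ys

  remove-length : ∀ {x ys} → x ∈ ys → suc (length (remove x ys)) ≡ length ys
  remove-length {x} {y ∷ ys} x∈ with x ≟ y
  remove-length (here _) | yes _ = refl
  remove-length (there _) | yes _ = refl
  remove-length (here x≡y) | no x≢y = ⊥-elim (x≢y x≡y)
  remove-length (there x∈) | no _ = cong suc (remove-length x∈)

  ∈-remove⁺ : ∀ {x y ys} → y ∈ ys → ¬ y ≡ x → y ∈ remove x ys
  ∈-remove⁺ {x} {y} {z ∷ ys} y∈ y≢x with x ≟ z
  ∈-remove⁺ (here refl) y≢x | yes refl = ⊥-elim (y≢x refl)
  ∈-remove⁺ (there y∈) y≢x | yes _ = y∈
  ∈-remove⁺ (here y≡z) y≢x | no _ = here y≡z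
  ∈-remove⁺ (there y∈) y≢x | no _ = there (∈-remove⁺ y∈ y≢x)

  ∈-remove⁻ : ∀ {x a} (ys : List A) → a ∈ remove x ys → a ∈ ys
  ∈-remove⁻ {x} (y ∷ ys) a∈ with x ≟ y
  ∈-remove⁻ (y ∷ ys) a∈ | yes _ = there a∈
  ∈-remove⁻ (y ∷ ys) (here a≡y) | no _ = here a≡y
  ∈-remove⁻ (y ∷ ys) (there a∈) | no _ = there (∈-remove⁻ ys a∈)

  remove-unique : ∀ {x ys} → Unique ys → Unique (remove x ys)
  remove-unique {x} {[]} u = []
  remove-unique {x} {y ∷ ys} (y∉ ∷ u) with x ≟ y
  ... | yes _ = u
  ... | no _ = All.tabulate (λ a∈ → All.lookup y∉ (∈-remove⁻ ys a∈)) ∷ remove-unique u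

  ∉-remove : ∀ {x ys} → Unique ys → x ∉ remove x ys
  ∉-remove {x} {y ∷ ys} (y∉ ∷ u) x∈ with x ≟ y
  ∉-remove (y∉ ∷ u) x∈ | yes refl = All.lookup y∉ x∈ refl
  ∉-remove (y∉ ∷ u) (here x≡y) | no x≢y = x≢y x≡y
  ∉-remove (y∉ ∷ u) (there x∈) | no _ = ∉-remove u x∈

  pigeonhole : ∀ {xs ys} → Unique xs → (∀ {a} → a ∈ xs → a ∈ ys) → length xs ≤ length ys
  pigeonhole {[]} u sub = z≤n
  pigeonhole {x ∷ xs} (x∉ ∷ u) sub =
    subst (suc (length xs) ≤_) (remove-length (sub (here refl)))
      (s≤s (pigeonhole u (λ a∈ → ∈-remove⁺ (sub (there a∈)) (λ a≡x → All.lookup x∉ a∈ (sym a≡x)))))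

  position : A → List A → ℕ
  position x [] = 0
  position x (y ∷ ys) with x ≟ y
  ... | yes _ = 0
  ... | no _ = suc (position x ys)

  position-< : ∀ {x} (ys : List A) → x ∈ ys → position x ys < length ys
  position-< {x} (y ∷ ys) x∈ with x ≟ y
  position-< (y ∷ ys) x∈ | yes _ = s≤s z≤n
  position-< (y ∷ ys) (here x≡y) | no x≢y = ⊥-elim (x≢y x≡y)
  position-< (y ∷ ys) (there x∈) | no _ = s≤s (position-< ys x∈)

  assoc : {B : Set} → List (A × B) → A → B → B
  assoc [] a d = d
  assoc ((x , b) ∷ ps) a d with x ≟ a
  ... | yes _ = b
  ... | no _ = assoc ps a d

  assoc-zip : {B : Set} {xs : List A} {ys : List B} (d : A → B) → Unique xs →
    length xs ≡ length ys → map (λ a → assoc (zip xs ys) a (d a)) xs ≡ ys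
  assoc-zip {xs = []} {[]} d u e = refl
  assoc-zip {xs = x ∷ xs} {y ∷ ys} d (x∉ ∷ u) e with x ≟ x
  ... | no x≢x = ⊥-elim (x≢x refl)
  ... | yes _ = cong (y ∷_) (trans (map-cong-∈ skip) (assoc-zip d u (ℕP.suc-injective e)))
    where
    skip : ∀ {a} → a ∈ xs → assoc ((x , y) ∷ zip xs ys) a (d a) ≡ assoc (zip xs ys) a (d a)
    skip {a} a∈ with x ≟ a
    ... | yes x≡a = ⊥-elim (All.lookup x∉ a∈ x≡a)
    ... | no _ = refl

  assoc-∈ : {B : Set} {xs : List A} {ys : List B} {a : A} (d : B) →
    length xs ≡ length ys → a ∈ xs → assoc (zip xs ys) a d ∈ ys
  assoc-∈ {xs = x ∷ xs} {y ∷ ys} {a} d e a∈ with x ≟ a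
  assoc-∈ d e a∈ | yes _ = here refl
  assoc-∈ d e (here refl) | no x≢a = ⊥-elim (x≢a refl)
  assoc-∈ d e (there a∈) | no _ = there (assoc-∈ d (ℕP.suc-injective e) a∈)

  ∈-tail : ∀ {x a : A} {xs : List A} → a ∈ x ∷ xs → ¬ x ≡ a → a ∈ xs
  ∈-tail (here refl) x≢a = ⊥-elim (x≢a refl)
  ∈-tail (there a∈) _ = a∈

  assoc-injective : {B : Set} {xs : List A} {ys : List B} {a b : A} (d d' : B) →
    Unique xs → Unique ys → length xs ≡ length ys → a ∈ xs → b ∈ xs →
    assoc (zip xs ys) a d ≡ assoc (zip xs ys) b d' → a ≡ b
  assoc-injective {xs = x ∷ xs} {y ∷ ys} {a} {b} d d' (_ ∷ u) (y∉ ∷ v) e a∈ b∈ eq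
    with x ≟ a | x ≟ b
  ... | yes x≡a | yes x≡b = trans (sym x≡a) x≡b
  ... | yes _ | no x≢b = ⊥-elim (All.lookup y∉ (assoc-∈ d' (ℕP.suc-injective e) (∈-tail b∈ x≢b)) eq)
  ... | no x≢a | yes _ = ⊥-elim (All.lookup y∉ (assoc-∈ d (ℕP.suc-injective e) (∈-tail a∈ x≢a)) (sym eq))
  ... | no x≢a | no x≢b =
    assoc-injective d d' u v (ℕP.suc-injective e) (∈-tail a∈ x≢a) (∈-tail b∈ x≢b) eq

  position-insert : ∀ {x} (p : ℕ) (l : List A) → x ∉ l → p ≤ length l → position x (insert p x l) ≡ p
  position-insert {x} zero l x∉ p≤ with x ≟ x
  ... | yes _ = refl
  ... | no x≢x = ⊥-elim (x≢x refl)
  position-insert {x} (suc p) (y ∷ l) x∉ (s≤s p≤) with x ≟ y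
  ... | yes x≡y = ⊥-elim (x∉ (here x≡y))
  ... | no _ = cong suc (position-insert p l (λ x∈ → x∉ (there x∈)) p≤)

  remove-insert : ∀ {x} (p : ℕ) (l : List A) → x ∉ l → remove x (insert p x l) ≡ l
  remove-insert {x} zero l x∉ with x ≟ x
  ... | yes _ = refl
  ... | no x≢x = ⊥-elim (x≢x refl)
  remove-insert {x} (suc p) [] x∉ with x ≟ x
  ... | yes _ = refl
  ... | no x≢x = ⊥-elim (x≢x refl)
  remove-insert {x} (suc p) (y ∷ l) x∉ with x ≟ y
  ... | yes x≡y = ⊥-elim (x∉ (here x≡y))
  ... | no _ = cong (y ∷_) (remove-insert p l (λ x∈ → x∉ (there x∈)))

  insert-position-remove : ∀ {x} (l : List A) → x ∈ l → insert (position x l) x (remove x l) ≡ l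
  insert-position-remove {x} (y ∷ l) x∈ with x ≟ y
  insert-position-remove (y ∷ l) x∈ | yes refl = refl
  insert-position-remove (y ∷ l) (here x≡y) | no x≢y = ⊥-elim (x≢y x≡y)
  insert-position-remove (y ∷ z ∷ l) (there x∈) | no _ = cong (y ∷_) (insert-position-remove (z ∷ l) x∈)

  occurrences : A → List A → ℕ
  occurrences k xs = length (filter (_≟ k) xs)

  occurrences-++ : (k : A) (xs ys : List A) → occurrences k (xs ++ ys) ≡ occurrences k xs ℕ.+ occurrences k ys
  occurrences-++ k xs ys = trans (cong length (LP.filter-++ (_≟ k) xs ys)) (LP.length-++ (filter (_≟ k) xs))

  occurrences-map : {B : Set} (f : B → A) (k : A) (xs : List B) →
    length (filter (λ b → f b ≟ k) xs) ≡ occurrences k (map f xs)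
  occurrences-map f k [] = refl
  occurrences-map f k (x ∷ xs) with f x ≟ k
  ... | yes _ = cong suc (occurrences-map f k xs)
  ... | no _ = occurrences-map f k xs

  map-filter-const : {B : Set} (f : B → A) (k : A) (xs : List B) →
    map f (filter (λ b → f b ≟ k) xs) ≡ replicate (length (filter (λ b → f b ≟ k) xs)) k
  map-filter-const f k [] = refl
  map-filter-const f k (x ∷ xs) with f x ≟ k
  ... | yes fx≡k = cong₂ _∷_ fx≡k (map-filter-const f k xs)
  ... | no _ = map-filter-const f k xs

module RingSums {c ℓ : Level} (R : CommutativeRing c ℓ) where
  open CommutativeRing R
    renaming (refl to ≈-refl; sym to ≈-sym; trans to ≈-trans; reflexive to ≈-reflexive)
    hiding (zero)
  open import Relation.Binary.Reasoning.Setoid setoid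

  Σ : List Carrier → Carrier
  Σ = sumR R

  sum-++ : (xs ys : List Carrier) → Σ (xs ++ ys) ≈ Σ xs + Σ ys
  sum-++ [] ys = ≈-sym (+-identityˡ _)
  sum-++ (x ∷ xs) ys = ≈-trans (+-congˡ (sum-++ xs ys)) (≈-sym (+-assoc _ _ _))

  sum-↭ : {xs ys : List Carrier} → xs ↭ ys → Σ xs ≈ Σ ys
  sum-↭ p = PermS.foldr-commMonoid setoid +-isCommutativeMonoid (↭⇒↭ₛ′ isEquivalence p)

  sum-cong : {f g : A → Carrier} (xs : List A) → (∀ {a} → a ∈ xs → f a ≈ g a) →
    Σ (map f xs) ≈ Σ (map g xs)
  sum-cong [] h = ≈-refl
  sum-cong (x ∷ xs) h = +-cong (h (here refl)) (sum-cong xs (λ a∈ → h (there a∈)))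

  sum-concatMap : (g : B → Carrier) (f : A → List B) (xs : List A) →
    Σ (map g (concatMap f xs)) ≈ Σ (map (λ x → Σ (map g (f x))) xs)
  sum-concatMap g f [] = ≈-refl
  sum-concatMap g f (x ∷ xs) = begin
    Σ (map g (f x ++ concatMap f xs))                ≡⟨ cong Σ (LP.map-++ g (f x) _) ⟩
    Σ (map g (f x) ++ map g (concatMap f xs))        ≈⟨ sum-++ (map g (f x)) _ ⟩
    Σ (map g (f x)) + Σ (map g (concatMap f xs))     ≈⟨ +-congˡ (sum-concatMap g f xs) ⟩
    Σ (map g (f x)) + Σ (map (λ x → Σ (map g (f x))) xs) ∎

  sum-scale : (a : Carrier) (f : A → Carrier) (xs : List A) →
    Σ (map (λ x → a * f x) xs) ≈ a * Σ (map f xs)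
  sum-scale a f [] = ≈-sym (zeroʳ a)
  sum-scale a f (x ∷ xs) = ≈-trans (+-congˡ (sum-scale a f xs)) (≈-sym (distribˡ a (f x) _))

  sum-cartesianProduct : {A B : Set} (f : A → Carrier) (g : B → Carrier) (xs : List A) (ys : List B) →
    Σ (map (λ p → f (proj₁ p) * g (proj₂ p)) (cartesianProduct xs ys)) ≈ Σ (map f xs) * Σ (map g ys)
  sum-cartesianProduct f g [] ys = ≈-sym (zeroˡ _)
  sum-cartesianProduct {A} {B} f g (x ∷ xs) ys = begin
    Σ (map F (map (x ,_) ys ++ cartesianProduct xs ys))
      ≡⟨ cong Σ (LP.map-++ F (map (x ,_) ys) _) ⟩
    Σ (map F (map (x ,_) ys) ++ map F (cartesianProduct xs ys))
      ≈⟨ sum-++ (map F (map (x ,_) ys)) _ ⟩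
    Σ (map F (map (x ,_) ys)) + Σ (map F (cartesianProduct xs ys))
      ≈⟨ +-cong (≈-reflexive (cong Σ (sym (LP.map-∘ ys)))) (sum-cartesianProduct f g xs ys) ⟩
    Σ (map (λ y → f x * g y) ys) + Σ (map f xs) * Σ (map g ys)
      ≈⟨ +-congʳ (sum-scale (f x) g ys) ⟩
    f x * Σ (map g ys) + Σ (map f xs) * Σ (map g ys)
      ≈⟨ ≈-sym (distribʳ _ (f x) _) ⟩
    (f x + Σ (map f xs)) * Σ (map g ys) ∎
    where
    F : A × B → Carrier
    F p = f (proj₁ p) * g (proj₂ p)

  sum-bijection : (xs : List A) (ys : List B) (φ : A → B) (g : A → Carrier) (h : B → Carrier) →
    Unique xs → Unique ys →
    (∀ {a b} → a ∈ xs → b ∈ xs → φ a ≡ φ b → a ≡ b) →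
    (∀ {a} → a ∈ xs → φ a ∈ ys) →
    (∀ {b} → b ∈ ys → ∃ λ a → a ∈ xs × φ a ≡ b) →
    (∀ {a} → a ∈ xs → g a ≈ h (φ a)) →
    Σ (map g xs) ≈ Σ (map h ys)
  sum-bijection xs ys φ g h ux uy inj into onto weight = begin
    Σ (map g xs)               ≈⟨ sum-cong xs weight ⟩
    Σ (map (λ a → h (φ a)) xs) ≡⟨ cong Σ (LP.map-∘ xs) ⟩
    Σ (map h (map φ xs))       ≈⟨ sum-↭ (PermP.map⁺ h image↭ys) ⟩
    Σ (map h ys)               ∎
    where
    image⊆ys : ∀ {b} → b ∈ map φ xs → b ∈ ys
    image⊆ys b∈ with MP.∈-map⁻ φ b∈
    ... | a , a∈ , refl = into a∈
    ys⊆image : ∀ {b} → b ∈ ys → b ∈ map φ xs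
    ys⊆image b∈ with onto b∈
    ... | a , a∈ , refl = MP.∈-map⁺ φ a∈
    image↭ys : map φ xs ↭ ys
    image↭ys = ∼bag⇒↭ (unique∧set⇒bag (map-unique ux inj) uy (mk⇔ image⊆ys ys⊆image))

  pow-+ : (a : Carrier) (m n : ℕ) → pow R a (m ℕ.+ n) ≈ pow R a m * pow R a n
  pow-+ a zero n = ≈-sym (*-identityˡ _)
  pow-+ a (suc m) n = ≈-trans (*-congˡ (pow-+ a m n)) (≈-sym (*-assoc _ _ _))

-- the number of letters of w smaller than x, so that
-- inv (x ∷ w) = smaller x w + inv w
smaller : ℕ → List ℕ → ℕ
smaller x w = length (filterᵇ (λ z → z <ᵇ x) w)

<ᵇ-false : {a x : ℕ} → a < x → (x <ᵇ a) ≡ false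
<ᵇ-false {a} {x} a<x with x <ᵇ a in eq
... | false = refl
... | true = ⊥-elim (ℕP.<-asym a<x (ℕP.<ᵇ⇒< x a (subst T (sym eq) _)))

smaller-insert : {a x : ℕ} → a < x → (p : ℕ) (l : List ℕ) → smaller a (insert p x l) ≡ smaller a l
smaller-insert a<x zero l rewrite <ᵇ-false a<x = refl
smaller-insert a<x (suc p) [] rewrite <ᵇ-false a<x = refl
smaller-insert {a} a<x (suc p) (y ∷ l) with y <ᵇ a
... | true = cong suc (smaller-insert a<x p l)
... | false = smaller-insert a<x p l

smaller-all : {x : ℕ} (l : List ℕ) → All (_< x) l → smaller x l ≡ length l
smaller-all [] [] = refl
smaller-all {x} (y ∷ l) (y<x ∷ l<x) with y <ᵇ x in eq
... | true = cong suc (smaller-all l l<x)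
... | false = ⊥-elim (subst T eq (ℕP.<⇒<ᵇ y<x))

-- A letter above all letters of l, inserted at position p, creates exactly
-- one inversion with each of the length l ∸ p letters to its right.
inv-insert : {x : ℕ} (p : ℕ) (l : List ℕ) → All (_< x) l → p ≤ length l →
  inv (insert p x l) ≡ (length l ∸ p) ℕ.+ inv l
inv-insert zero l l<x p≤ = cong (ℕ._+ inv l) (smaller-all l l<x)
inv-insert {x} (suc p) (y ∷ l) (y<x ∷ l<x) (s≤s p≤) = begin
  smaller y (insert p x l) ℕ.+ inv (insert p x l)
    ≡⟨ cong₂ ℕ._+_ (smaller-insert y<x p l) (inv-insert p l l<x p≤) ⟩
  smaller y l ℕ.+ ((length l ∸ p) ℕ.+ inv l)
    ≡⟨ ℕP.+-comm (smaller y l) _ ⟩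
  ((length l ∸ p) ℕ.+ inv l) ℕ.+ smaller y l
    ≡⟨ ℕP.+-assoc (length l ∸ p) _ _ ⟩
  (length l ∸ p) ℕ.+ (inv l ℕ.+ smaller y l)
    ≡⟨ cong ((length l ∸ p) ℕ.+_) (ℕP.+-comm (inv l) _) ⟩
  (length l ∸ p) ℕ.+ (smaller y l ℕ.+ inv l) ∎
  where open ≡-Reasoning

words : List A → ℕ → List (List A)
words xs zero = [] ∷ []
words xs (suc n) = cartesianProductWith _∷_ xs (words xs n)

∈-words⁺ : {xs l : List A} (n : ℕ) → length l ≡ n → All (_∈ xs) l → l ∈ words xs n
∈-words⁺ {l = []} zero len [] = here refl
∈-words⁺ {l = x ∷ l} (suc n) len (x∈ ∷ l⊆) =
  MP.∈-cartesianProductWith⁺ _∷_ x∈ (∈-words⁺ n (ℕP.suc-injective len) l⊆)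

words-length : {xs l : List A} (n : ℕ) → l ∈ words xs n → length l ≡ n
words-length zero (here refl) = refl
words-length {xs = xs} (suc n) l∈ with MP.∈-cartesianProductWith⁻ _∷_ xs (words xs n) l∈
... | _ , l' , _ , l'∈ , refl = cong suc (words-length n l'∈)

words-unique : {xs : List A} (n : ℕ) → Unique xs → Unique (words xs n)
words-unique zero u = [] ∷ []
words-unique (suc n) u = UP.cartesianProductWith⁺ _∷_ (λ { refl → refl , refl }) u (words-unique n u)

arrangements : (n : ℕ) → List (List (Fin n))
arrangements n = filter (UniqueDec.unique? (FP._≟_ {n})) (words (allFin n) n)

∈-arrangements⁺ : {n : ℕ} {w : List (Fin n)} → length w ≡ n → Unique w → w ∈ arrangements n
∈-arrangements⁺ {n} len u =
  MP.∈-filter⁺ (UniqueDec.unique? (FP._≟_ {n})) (∈-words⁺ n len (All.tabulate (λ {a} _ → MP.∈-allFin a))) u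

∈-arrangements⁻ : {n : ℕ} {w : List (Fin n)} → w ∈ arrangements n → length w ≡ n × Unique w
∈-arrangements⁻ {n} w∈ with MP.∈-filter⁻ (UniqueDec.unique? (FP._≟_ {n})) w∈
... | w∈words , u = words-length n w∈words , u

arrangements-unique : (n : ℕ) → Unique (arrangements n)
arrangements-unique n = UP.filter⁺ (UniqueDec.unique? (FP._≟_ {n})) (words-unique n (UP.allFin⁺ n))

-- By pigeonhole, an arrangement of {0,…,n-1} contains every element.
arrangement-complete : {n : ℕ} {w : List (Fin n)} → Unique w → length w ≡ n → (a : Fin n) → a ∈ w
arrangement-complete {n} {w} u len a with DecMembership._∈?_ FP._≟_ a w
... | yes a∈ = a∈
... | no a∉ = ⊥-elim (ℕP.<-irrefl refl (subst₂ _≤_ (cong suc len) (LP.length-tabulate (λ i → i)) too-long))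
  where
  open DecidableLists (FP._≟_ {n})
  too-long : suc (length w) ≤ length (allFin n)
  too-long = pigeonhole (All.tabulate (λ b∈ a≡b → a∉ (subst (_∈ w) (sym a≡b) b∈)) ∷ u) (λ {b} _ → MP.∈-allFin b)

-- Every arrangement of {0,…,n} is obtained
-- exactly once by inserting the letter n into an arrangement of {0,…,n-1};
-- inserting it j places from the right end creates j inversions.
module InsertLargest (n : ℕ) where
  open DecidableLists (FP._≟_ {suc n})

  largest : Fin (suc n)
  largest = fromℕ n

  -- (j , w) ↦ w with the letter n inserted j places from the right
  insertLargest : ℕ × List (Fin n) → List (Fin (suc n))
  insertLargest (j , w) = insert (n ∸ j) largest (map inject₁ w)

  pairs : List (ℕ × List (Fin n))
  pairs = cartesianProduct (downFrom (suc n)) (arrangements n)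

  pairs-unique : Unique pairs
  pairs-unique = UP.cartesianProduct⁺ (UP.downFrom⁺ (suc n)) (arrangements-unique n)

  largest∉ : (w : List (Fin n)) → largest ∉ map inject₁ w
  largest∉ w l∈ with MP.∈-map⁻ inject₁ l∈
  ... | a , _ , e = FP.fromℕ≢inject₁ e

  ∈-pairs⁻ : ∀ {j w} → (j , w) ∈ pairs → j ≤ n × w ∈ arrangements n
  ∈-pairs⁻ p∈ with MP.∈-cartesianProduct⁻ (downFrom (suc n)) (arrangements n) p∈
  ... | j∈ , w∈ = ℕP.≤-pred (MP.∈-downFrom⁻ j∈) , w∈

  length-lift : {w : List (Fin n)} → w ∈ arrangements n → length (map inject₁ w) ≡ n
  length-lift {w} w∈ = trans (LP.length-map inject₁ w) (proj₁ (∈-arrangements⁻ w∈))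

  insertLargest-∈ : ∀ {p} → p ∈ pairs → insertLargest p ∈ arrangements (suc n)
  insertLargest-∈ {j , w} p∈ with ∈-pairs⁻ p∈
  ... | _ , w∈ = ∈-arrangements⁺
    (trans (insert-length (n ∸ j) largest _) (cong suc (length-lift w∈)))
    (insert-unique (n ∸ j) (largest∉ w) (UP.map⁺ FP.inject₁-injective (proj₂ (∈-arrangements⁻ w∈))))

  -- the position of the inserted letter and the remaining word recover (j , w)
  insertLargest-injective : ∀ {p p'} → p ∈ pairs → p' ∈ pairs → insertLargest p ≡ insertLargest p' → p ≡ p'
  insertLargest-injective {j , w} {j' , w'} p∈ p'∈ e with ∈-pairs⁻ p∈ | ∈-pairs⁻ p'∈
  ... | j≤n , w∈ | j'≤n , w'∈ = cong₂ _,_ j≡j' w≡w'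
    where
    position≡ : ∀ {j w} → w ∈ arrangements n → position largest (insertLargest (j , w)) ≡ n ∸ j
    position≡ {j} {w} w∈ =
      position-insert (n ∸ j) _ (largest∉ w) (subst (n ∸ j ≤_) (sym (length-lift w∈)) (ℕP.m∸n≤m n j))
    j≡j' : j ≡ j'
    j≡j' = trans (sym (ℕP.m∸[m∸n]≡n j≤n))
             (trans (cong (n ∸_) (trans (sym (position≡ {j} w∈)) (trans (cong (position largest) e) (position≡ {j'} w'∈))))
                    (ℕP.m∸[m∸n]≡n j'≤n))
    w≡w' : w ≡ w'
    w≡w' = LP.map-injective FP.inject₁-injective
             (trans (sym (remove-insert (n ∸ j) _ (largest∉ w)))
                    (trans (cong (remove largest) e) (remove-insert (n ∸ j') _ (largest∉ w'))))

  lower : (r : List (Fin (suc n))) → (∀ {a} → a ∈ r → ¬ n ≡ toℕ a) → ∃ λ (l : List (Fin n)) → map inject₁ l ≡ r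
  lower [] avoid = [] , refl
  lower (a ∷ r) avoid with lower r (λ a∈ → avoid (there a∈))
  ... | l , e = Fin.lower₁ a (avoid (here refl)) ∷ l , cong₂ _∷_ (FP.inject₁-lower₁ a (avoid (here refl))) e

  insertLargest-onto : ∀ {v} → v ∈ arrangements (suc n) → ∃ λ p → p ∈ pairs × insertLargest p ≡ v
  insertLargest-onto {v} v∈ with ∈-arrangements⁻ v∈
  ... | len , u = (n ∸ i , w) , MP.∈-cartesianProduct⁺ (MP.∈-downFrom⁺ (s≤s (ℕP.m∸n≤m n i))) w∈ , inserted
    where
    largest∈ : largest ∈ v
    largest∈ = arrangement-complete u len largest
    i : ℕ
    i = position largest v
    i≤n : i ≤ n
    i≤n = ℕP.≤-pred (subst (suc i ≤_) len (position-< v largest∈))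
    avoid : ∀ {a} → a ∈ remove largest v → ¬ n ≡ toℕ a
    avoid {a} a∈ n≡a =
      ∉-remove u (subst (_∈ remove largest v) (FP.toℕ-injective (trans (sym n≡a) (sym (FP.toℕ-fromℕ n)))) a∈)
    w : List (Fin n)
    w = proj₁ (lower (remove largest v) avoid)
    lift-w : map inject₁ w ≡ remove largest v
    lift-w = proj₂ (lower (remove largest v) avoid)
    w∈ : w ∈ arrangements n
    w∈ = ∈-arrangements⁺
      (trans (sym (LP.length-map inject₁ w))
             (trans (cong length lift-w) (ℕP.suc-injective (trans (remove-length largest∈) len))))
      (UP.map⁻ (subst Unique (sym lift-w) (remove-unique u)))
    inserted : insert (n ∸ (n ∸ i)) largest (map inject₁ w) ≡ v
    inserted = trans (cong₂ (λ p l → insert p largest l) (ℕP.m∸[m∸n]≡n i≤n) lift-w)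
                     (insert-position-remove v largest∈)

  inv-insertLargest : ∀ {j w} → (j , w) ∈ pairs →
    inv (map toℕ (insertLargest (j , w))) ≡ j ℕ.+ inv (map toℕ w)
  inv-insertLargest {j} {w} p∈ with ∈-pairs⁻ p∈
  ... | j≤n , w∈ = begin
    inv (map toℕ (insert (n ∸ j) largest (map inject₁ w)))
      ≡⟨ cong inv (map-insert toℕ (n ∸ j) largest _) ⟩
    inv (insert (n ∸ j) (toℕ largest) (map toℕ (map inject₁ w)))
      ≡⟨ cong (λ l → inv (insert (n ∸ j) (toℕ largest) l)) lowered ⟩
    inv (insert (n ∸ j) (toℕ largest) (map toℕ w))
      ≡⟨ cong (λ x → inv (insert (n ∸ j) x (map toℕ w))) (FP.toℕ-fromℕ n) ⟩
    inv (insert (n ∸ j) n (map toℕ w))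
      ≡⟨ inv-insert (n ∸ j) (map toℕ w) letters<n (subst (n ∸ j ≤_) (sym length≡) (ℕP.m∸n≤m n j)) ⟩
    (length (map toℕ w) ∸ (n ∸ j)) ℕ.+ inv (map toℕ w)
      ≡⟨ cong (λ m → (m ∸ (n ∸ j)) ℕ.+ inv (map toℕ w)) length≡ ⟩
    (n ∸ (n ∸ j)) ℕ.+ inv (map toℕ w)
      ≡⟨ cong (ℕ._+ inv (map toℕ w)) (ℕP.m∸[m∸n]≡n j≤n) ⟩
    j ℕ.+ inv (map toℕ w) ∎
    where
    open ≡-Reasoning
    lowered : map toℕ (map inject₁ w) ≡ map toℕ w
    lowered = trans (sym (LP.map-∘ w)) (LP.map-cong FP.toℕ-inject₁ w)
    length≡ : length (map toℕ w) ≡ n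
    length≡ = trans (LP.length-map toℕ w) (proj₁ (∈-arrangements⁻ w∈))
    letters<n : All (_< n) (map toℕ w)
    letters<n = All.tabulate λ a∈ → letter<n (MP.∈-map⁻ toℕ a∈)
      where
      letter<n : ∀ {a} → ∃ (λ i → i ∈ w × a ≡ toℕ i) → a < n
      letter<n (i , _ , refl) = FP.toℕ<n i

module QIntegers {c ℓ : Level} (R : CommutativeRing c ℓ) (q : CommutativeRing.Carrier R) where
  open CommutativeRing R
    renaming (refl to ≈-refl; sym to ≈-sym; trans to ≈-trans; reflexive to ≈-reflexive)
    hiding (zero)
  open RingSums R
  open NatCoeffSolver commutativeSemiring using (solve; _:+_; _:*_; _:=_; con)
  open import Relation.Binary.Reasoning.Setoid setoid

  [_] : ℕ → Carrier
  [ m ] = qint R q m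

  qint-suc : (m : ℕ) → [ suc m ] ≈ pow R q m + [ m ]
  qint-suc zero = +-congˡ (zeroʳ q)
  qint-suc (suc m) = begin
    1# + q * [ suc m ]               ≈⟨ +-congˡ (*-congˡ (qint-suc m)) ⟩
    1# + q * (pow R q m + [ m ])     ≈⟨ solve 3 (λ q a b → con 1 :+ q :* (a :+ b) := q :* a :+ (con 1 :+ q :* b)) ≈-refl q _ _ ⟩
    q * pow R q m + (1# + q * [ m ]) ∎

  geometric-sum : (m : ℕ) → Σ (map (pow R q) (downFrom m)) ≈ [ m ]
  geometric-sum zero = ≈-refl
  geometric-sum (suc m) = ≈-trans (+-congˡ (geometric-sum m)) (≈-sym (qint-suc m))

  qint-+ : (m n : ℕ) → [ m ℕ.+ n ] ≈ [ m ] + pow R q m * [ n ]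
  qint-+ zero n = ≈-sym (≈-trans (+-identityˡ _) (*-identityˡ _))
  qint-+ (suc m) n = begin
    1# + q * [ m ℕ.+ n ]                  ≈⟨ +-congˡ (*-congˡ (qint-+ m n)) ⟩
    1# + q * ([ m ] + pow R q m * [ n ])  ≈⟨ solve 4 (λ q a b c → con 1 :+ q :* (a :+ b :* c) := (con 1 :+ q :* a) :+ (q :* b) :* c) ≈-refl q _ _ _ ⟩
    (1# + q * [ m ]) + (q * pow R q m) * [ n ] ∎

  -- shiftedFactorial α n = ∏_{k=1}^{n} [α+k]_q; for α = 0 it is n!_q
  shiftedFactorial : ℕ → ℕ → Carrier
  shiftedFactorial α zero = 1#
  shiftedFactorial α (suc k) = [ α ℕ.+ suc k ] * shiftedFactorial α k

  shiftedFactorial-suc : (α k : ℕ) → shiftedFactorial α (suc k) ≈ [ α ℕ.+ 1 ] * shiftedFactorial (suc α) k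
  shiftedFactorial-suc α zero = ≈-refl
  shiftedFactorial-suc α (suc k) = begin
    [ α ℕ.+ suc (suc k) ] * shiftedFactorial α (suc k)
      ≈⟨ *-congˡ (shiftedFactorial-suc α k) ⟩
    [ α ℕ.+ suc (suc k) ] * ([ α ℕ.+ 1 ] * shiftedFactorial (suc α) k)
      ≈⟨ solve 3 (λ a b c → a :* (b :* c) := b :* (a :* c)) ≈-refl _ _ _ ⟩
    [ α ℕ.+ 1 ] * ([ α ℕ.+ suc (suc k) ] * shiftedFactorial (suc α) k)
      ≡⟨ cong (λ m → [ α ℕ.+ 1 ] * ([ m ] * shiftedFactorial (suc α) k)) (ℕP.+-suc α (suc k)) ⟩
    [ α ℕ.+ 1 ] * ([ suc α ℕ.+ suc k ] * shiftedFactorial (suc α) k) ∎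

module Mahonian {c ℓ : Level} (R : CommutativeRing c ℓ) (q : CommutativeRing.Carrier R) where
  open CommutativeRing R
    renaming (refl to ≈-refl; sym to ≈-sym; trans to ≈-trans; reflexive to ≈-reflexive)
    hiding (zero)
  open RingSums R
  open QIntegers R q
  open import Relation.Binary.Reasoning.Setoid setoid

  invSum : ℕ → Carrier
  invSum n = Σ (map (λ w → pow R q (inv (map toℕ w))) (arrangements n))

  mahonian : (n : ℕ) → invSum n ≈ shiftedFactorial 0 n
  mahonian zero = +-identityʳ 1#
  mahonian (suc n) = begin
    invSum (suc n)
      ≈⟨ ≈-sym (sum-bijection pairs (arrangements (suc n)) insertLargest weight
                  (λ v → pow R q (inv (map toℕ v))) pairs-unique
                  (arrangements-unique (suc n)) insertLargest-injective insertLargest-∈ insertLargest-onto weight≈) ⟩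
    Σ (map weight pairs)
      ≈⟨ sum-cartesianProduct (pow R q) (λ w → pow R q (inv (map toℕ w))) (downFrom (suc n)) (arrangements n) ⟩
    Σ (map (pow R q) (downFrom (suc n))) * invSum n
      ≈⟨ *-cong (geometric-sum (suc n)) (mahonian n) ⟩
    [ suc n ] * shiftedFactorial 0 n ∎
    where
    open InsertLargest n
    weight : ℕ × List (Fin n) → Carrier
    weight (j , w) = pow R q j * pow R q (inv (map toℕ w))
    weight≈ : ∀ {p} → p ∈ pairs → weight p ≈ pow R q (inv (map toℕ (insertLargest p)))
    weight≈ {j , w} p∈ = ≈-sym (≈-trans (≈-reflexive (cong (pow R q) (inv-insertLargest p∈))) (pow-+ q j _))

-- the compositions m = (m₀,…,m_α) of n into α+1 parts (zero parts allowed),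
-- listed by the sum i of the parts after the first
compositions : (α n : ℕ) → List (Vec ℕ (suc α))
compositions zero n = (n ∷ []) ∷ []
compositions (suc α) n = concatMap (λ i → map ((n ∸ i) ∷_) (compositions α i)) (downFrom (suc n))

∈-compositions⁻ : (α n : ℕ) {m : Vec ℕ (suc α)} → m ∈ compositions α n → Vec.sum m ≡ n
∈-compositions⁻ zero n (here refl) = ℕP.+-identityʳ n
∈-compositions⁻ (suc α) n m∈ with ∈-concatMap⁻ (downFrom (suc n)) m∈
... | i , i∈ , m∈' with MP.∈-map⁻ ((n ∸ i) ∷_) m∈'
... | m' , m'∈ , refl =
  trans (cong ((n ∸ i) ℕ.+_) (∈-compositions⁻ α i m'∈)) (ℕP.m∸n+n≡m (ℕP.≤-pred (MP.∈-downFrom⁻ i∈)))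

∈-compositions⁺ : (α n : ℕ) (m : Vec ℕ (suc α)) → Vec.sum m ≡ n → m ∈ compositions α n
∈-compositions⁺ zero n (x ∷ []) sum≡ = here (cong (_∷ []) (trans (sym (ℕP.+-identityʳ x)) sum≡))
∈-compositions⁺ (suc α) n (x ∷ m') sum≡ =
  subst (λ z → (z ∷ m') ∈ compositions (suc α) n) first≡
    (∈-concatMap⁺ (MP.∈-downFrom⁺ (s≤s rest≤n)) (MP.∈-map⁺ ((n ∸ Vec.sum m') ∷_) (∈-compositions⁺ α _ m' refl)))
  where
  rest≤n : Vec.sum m' ≤ n
  rest≤n = subst (Vec.sum m' ≤_) sum≡ (ℕP.m≤n+m (Vec.sum m') x)
  first≡ : n ∸ Vec.sum m' ≡ x
  first≡ = trans (cong (_∸ Vec.sum m') (sym sum≡)) (ℕP.m+n∸n≡m x (Vec.sum m'))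

compositions-unique : (α n : ℕ) → Unique (compositions α n)
compositions-unique zero n = [] ∷ []
compositions-unique (suc α) n =
  concatMap-unique (λ m → Vec.sum (Vec.tail m)) (UP.downFrom⁺ (suc n))
    (λ i → UP.map⁺ (λ { refl → refl }) (compositions-unique α i)) rest-sum
  where
  rest-sum : ∀ {i m} → m ∈ map ((n ∸ i) ∷_) (compositions α i) → Vec.sum (Vec.tail m) ≡ i
  rest-sum {i} m∈ with MP.∈-map⁻ ((n ∸ i) ∷_) m∈
  ... | m' , m'∈ , refl = ∈-compositions⁻ α i m'∈

zeroOneWord : {α : ℕ} → Vec ℕ (suc α) → List ℕ
zeroOneWord {α} m =
  replicate (lookup m Fin.zero) 0 ++ concat (map (λ k → 1 ∷ replicate (lookup m (Fin.suc k)) 0) (allFin α))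

zeroOneWord-cons : {α : ℕ} (j : ℕ) (m : Vec ℕ (suc α)) →
  zeroOneWord (j ∷ m) ≡ replicate j 0 ++ (1 ∷ zeroOneWord m)
zeroOneWord-cons {α} j m = cong (λ ks → replicate j 0 ++ concat ks) (map-allFin-suc segment)
  where
  segment : Fin (suc α) → List ℕ
  segment k = 1 ∷ replicate (lookup (j ∷ m) (Fin.suc k)) 0

inv-zeros : (j : ℕ) (w : List ℕ) → inv (replicate j 0 ++ w) ≡ inv w
inv-zeros zero w = refl
inv-zeros (suc j) w = trans (cong (ℕ._+ inv (replicate j 0 ++ w)) (nothing<0 (replicate j 0 ++ w))) (inv-zeros j w)
  where
  nothing<0 : (v : List ℕ) → smaller 0 v ≡ 0
  nothing<0 [] = refl
  nothing<0 (x ∷ v) = nothing<0 v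

smaller1-zeros : (j : ℕ) (w : List ℕ) → smaller 1 (replicate j 0 ++ w) ≡ j ℕ.+ smaller 1 w
smaller1-zeros zero w = refl
smaller1-zeros (suc j) w = cong suc (smaller1-zeros j w)

smaller1-zeroOneWord : {α : ℕ} (m : Vec ℕ (suc α)) → smaller 1 (zeroOneWord m) ≡ Vec.sum m
smaller1-zeroOneWord {zero} (j ∷ []) = smaller1-zeros j []
smaller1-zeroOneWord {suc α} (j ∷ m) =
  trans (cong (smaller 1) (zeroOneWord-cons j m))
        (trans (smaller1-zeros j (1 ∷ zeroOneWord m)) (cong (j ℕ.+_) (smaller1-zeroOneWord m)))

-- the first 1 forms an inversion with each later 0
inv-zeroOneWord-cons : {α : ℕ} (j : ℕ) (m : Vec ℕ (suc α)) →
  inv (zeroOneWord (j ∷ m)) ≡ Vec.sum m ℕ.+ inv (zeroOneWord m)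
inv-zeroOneWord-cons j m =
  trans (cong inv (zeroOneWord-cons j m))
        (trans (inv-zeros j (1 ∷ zeroOneWord m)) (cong (ℕ._+ inv (zeroOneWord m)) (smaller1-zeroOneWord m)))

module CompositionSum {c ℓ : Level} (R : CommutativeRing c ℓ) (q : CommutativeRing.Carrier R) where
  open CommutativeRing R
    renaming (refl to ≈-refl; sym to ≈-sym; trans to ≈-trans; reflexive to ≈-reflexive)
    hiding (zero)
  open RingSums R
  open QIntegers R q
  open NatCoeffSolver commutativeSemiring using (solve; _:+_; _:*_; _:=_)
  open import Relation.Binary.Reasoning.Setoid setoid

  compositionSum : ℕ → ℕ → Carrier
  compositionSum α n = Σ (map (λ m → pow R q (inv (zeroOneWord m))) (compositions α n))

  -- with a single part, σ̲̲ = 0^n has no inversions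
  compositionSum-zero : (n : ℕ) → compositionSum zero n ≈ 1#
  compositionSum-zero n = ≈-trans (+-identityʳ _) (≈-reflexive (cong (pow R q) (inv-zeros n [])))

  -- splitting off the first part, whose complement i contributes q^i
  compositionSum-suc : (α n : ℕ) →
    compositionSum (suc α) n ≈ Σ (map (λ i → pow R q i * compositionSum α i) (downFrom (suc n)))
  compositionSum-suc α n = begin
    compositionSum (suc α) n
      ≈⟨ sum-concatMap weight (λ i → map ((n ∸ i) ∷_) (compositions α i)) (downFrom (suc n)) ⟩
    Σ (map (λ i → Σ (map weight (map ((n ∸ i) ∷_) (compositions α i)))) (downFrom (suc n)))
      ≈⟨ sum-cong (downFrom (suc n)) (λ {i} _ → first-part i) ⟩
    Σ (map (λ i → pow R q i * compositionSum α i) (downFrom (suc n))) ∎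
    where
    weight : Vec ℕ (suc (suc α)) → Carrier
    weight m = pow R q (inv (zeroOneWord m))
    first-part : (i : ℕ) → Σ (map weight (map ((n ∸ i) ∷_) (compositions α i))) ≈ pow R q i * compositionSum α i
    first-part i = begin
      Σ (map weight (map ((n ∸ i) ∷_) (compositions α i)))
        ≡⟨ cong Σ (sym (LP.map-∘ (compositions α i))) ⟩
      Σ (map (λ m → weight ((n ∸ i) ∷ m)) (compositions α i))
        ≈⟨ sum-cong (compositions α i) (λ {m} m∈ → ≈-trans
             (≈-reflexive (cong (pow R q) (trans (inv-zeroOneWord-cons (n ∸ i) m)
                                                  (cong (ℕ._+ inv (zeroOneWord m)) (∈-compositions⁻ α i m∈)))))
             (pow-+ q i _)) ⟩
      Σ (map (λ m → pow R q i * pow R q (inv (zeroOneWord m))) (compositions α i))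
        ≈⟨ sum-scale (pow R q i) _ (compositions α i) ⟩
      pow R q i * compositionSum α i ∎

  -- the q-Pascal recurrence, from the term i = k+1 of compositionSum-suc
  compositionSum-pascal : (α k : ℕ) →
    compositionSum (suc α) (suc k) ≈ pow R q (suc k) * compositionSum α (suc k) + compositionSum (suc α) k
  compositionSum-pascal α k = ≈-trans (compositionSum-suc α (suc k)) (+-congˡ (≈-sym (compositionSum-suc α k)))

  qfactorial-compositionSum : (α n : ℕ) → shiftedFactorial 0 n * compositionSum α n ≈ shiftedFactorial α n
  qfactorial-compositionSum zero n = ≈-trans (*-congˡ (compositionSum-zero n)) (*-identityʳ _)
  qfactorial-compositionSum (suc α) zero = begin
    1# * compositionSum (suc α) 0        ≈⟨ *-identityˡ _ ⟩
    compositionSum (suc α) 0             ≈⟨ compositionSum-suc α 0 ⟩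
    1# * compositionSum α 0 + 0#         ≈⟨ +-identityʳ _ ⟩
    1# * compositionSum α 0              ≈⟨ qfactorial-compositionSum α 0 ⟩
    1# ∎
  qfactorial-compositionSum (suc α) (suc k) = begin
    (a * f) * compositionSum (suc α) (suc k)
      ≈⟨ *-congˡ (compositionSum-pascal α k) ⟩
    (a * f) * (b * compositionSum α (suc k) + compositionSum (suc α) k)
      ≈⟨ solve 5 (λ a f b x y → (a :* f) :* (b :* x :+ y) := b :* (a :* f :* x) :+ a :* (f :* y)) ≈-refl a f b _ _ ⟩
    b * ((a * f) * compositionSum α (suc k)) + a * (f * compositionSum (suc α) k)
      ≈⟨ +-cong (*-congˡ (qfactorial-compositionSum α (suc k))) (*-congˡ (qfactorial-compositionSum (suc α) k)) ⟩
    b * shiftedFactorial α (suc k) + a * shiftedFactorial (suc α) k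
      ≈⟨ +-congʳ (*-congˡ (shiftedFactorial-suc α k)) ⟩
    b * ([ α ℕ.+ 1 ] * shiftedFactorial (suc α) k) + a * shiftedFactorial (suc α) k
      ≈⟨ solve 4 (λ a b x y → b :* (x :* y) :+ a :* y := (a :+ b :* x) :* y) ≈-refl a b _ _ ⟩
    (a + b * [ α ℕ.+ 1 ]) * shiftedFactorial (suc α) k
      ≈⟨ *-congʳ (≈-sym (qint-+ (suc k) (α ℕ.+ 1))) ⟩
    [ suc k ℕ.+ (α ℕ.+ 1) ] * shiftedFactorial (suc α) k
      ≡⟨ cong (λ m → [ m ] * shiftedFactorial (suc α) k) index≡ ⟩
    [ suc α ℕ.+ suc k ] * shiftedFactorial (suc α) k ∎
    where
    a b f : Carrier
    a = [ suc k ]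
    b = pow R q (suc k)
    f = shiftedFactorial 0 k
    index≡ : suc k ℕ.+ (α ℕ.+ 1) ≡ suc α ℕ.+ suc k
    index≡ = trans (ℕP.+-comm (suc k) (α ℕ.+ 1)) (cong (ℕ._+ suc k) (ℕP.+-comm α 1))

module LaguerreAtZero {c ℓ : Level} (R : CommutativeRing c ℓ) (α : ℕ) (y q : CommutativeRing.Carrier R) where
  open CommutativeRing R
    renaming (refl to ≈-refl; sym to ≈-sym; trans to ≈-trans; reflexive to ≈-reflexive)
    hiding (zero)
  open QIntegers R q
  open NatCoeffSolver commutativeSemiring using (solve; _:+_; _:*_; _:=_; con)
  open import Algebra.Properties.Ring ring using (-1*x≈-x; -0#≈0#; -‿involutive)
  open import Algebra.Properties.Group +-group using (//-rightDividesʳ)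
  open import Relation.Binary.Reasoning.Setoid setoid

  M : ℕ → Carrier
  M n = LagBar R α 0# y q n

  -- (-1)² = 1, so that the signs (-1)^n can be moved through the recurrence
  -1²≈1 : - 1# * - 1# ≈ 1#
  -1²≈1 = ≈-trans (-1*x≈-x (- 1#)) (-‿involutive 1#)

  M-one : M 1 ≈ pow R y 1 * shiftedFactorial α 1
  M-one = begin
    (u * 1#) * ((- 0# + - (y * a + 0#)) * 1# + - (y * 0# * [ α ] * 0#))
      ≈⟨ *-congˡ (+-cong (*-congʳ (+-cong -0#≈0# (≈-sym (-1*x≈-x _)))) (≈-trans (-‿cong (zeroʳ _)) -0#≈0#)) ⟩
    (u * 1#) * ((0# + u * (y * a + 0#)) * 1# + 0#)
      ≈⟨ solve 3 (λ u y a → (u :* con 1) :* ((con 0 :+ u :* (y :* a :+ con 0)) :* con 1 :+ con 0)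
                          := (u :* u) :* ((y :* con 1) :* (a :* con 1))) ≈-refl u y a ⟩
    (u * u) * ((y * 1#) * (a * 1#))
      ≈⟨ ≈-trans (*-congʳ -1²≈1) (*-identityˡ _) ⟩
    (y * 1#) * (a * 1#) ∎
    where
    u a : Carrier
    u = - 1#
    a = [ α ℕ.+ 1 ]

  M-recurrence : (n : ℕ) → M (suc (suc n)) ≈
    (y * [ suc n ℕ.+ α ℕ.+ 1 ] + [ suc n ]) * M (suc n) + - (y * [ suc n ] * [ suc n ℕ.+ α ] * M n)
  M-recurrence n = begin
    (u * (u * w)) * ((- 0# + - s) * L₁ + - (t * L₀))
      ≈⟨ *-congˡ (+-cong (*-congʳ -s≈us) (≈-sym (-1*x≈-x _))) ⟩
    (u * (u * w)) * ((u * s) * L₁ + u * (t * L₀))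
      ≈⟨ solve 6 (λ u w s t L₁ L₀ → (u :* (u :* w)) :* ((u :* s) :* L₁ :+ u :* (t :* L₀))
                                   := (u :* u) :* (s :* ((u :* w) :* L₁)) :+ u :* ((u :* u) :* (t :* (w :* L₀))))
                 ≈-refl u w s t L₁ L₀ ⟩
    (u * u) * (s * M (suc n)) + u * ((u * u) * (t * M n))
      ≈⟨ +-cong (≈-trans (*-congʳ -1²≈1) (*-identityˡ _)) (*-congˡ (≈-trans (*-congʳ -1²≈1) (*-identityˡ _))) ⟩
    s * M (suc n) + u * (t * M n)
      ≈⟨ +-congˡ (-1*x≈-x _) ⟩
    s * M (suc n) + - (t * M n) ∎
    where
    u w s t L₁ L₀ : Carrier
    u = - 1#
    w = pow R u n
    s = y * [ suc n ℕ.+ α ℕ.+ 1 ] + [ suc n ]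
    t = y * [ suc n ] * [ suc n ℕ.+ α ]
    L₁ = Lag R α (- 0#) y q (suc n)
    L₀ = Lag R α (- 0#) y q n
    -s≈us : - 0# + - s ≈ u * s
    -s≈us = ≈-trans (+-congʳ -0#≈0#) (≈-trans (+-identityˡ _) (≈-sym (-1*x≈-x s)))

  closed-form-step : (n : ℕ) →
    M n ≈ pow R y n * shiftedFactorial α n →
    M (suc n) ≈ pow R y (suc n) * shiftedFactorial α (suc n) →
    M (suc (suc n)) ≈ pow R y (suc (suc n)) * shiftedFactorial α (suc (suc n))
  closed-form-step n h₀ h₁ = begin
    M (suc (suc n))
      ≈⟨ M-recurrence n ⟩
    (y * a + b) * M (suc n) + - (y * b * d * M n)
      ≈⟨ +-cong (*-congˡ h₁) (-‿cong (*-cong (*-congˡ (≈-reflexive (cong [_] d-index))) h₀)) ⟩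
    (y * a + b) * ((y * yⁿ) * (e * p)) + - (y * b * e * (yⁿ * p))
      ≈⟨ +-congʳ (solve 6 (λ y a b e yⁿ p → (y :* a :+ b) :* ((y :* yⁿ) :* (e :* p))
                                         := (y :* (y :* yⁿ)) :* (a :* (e :* p)) :+ y :* b :* e :* (yⁿ :* p))
                        ≈-refl y a b e yⁿ p) ⟩
    ((y * (y * yⁿ)) * (a * (e * p)) + y * b * e * (yⁿ * p)) + - (y * b * e * (yⁿ * p))
      ≈⟨ //-rightDividesʳ _ _ ⟩
    (y * (y * yⁿ)) * (a * (e * p))
      ≡⟨ cong (λ m → (y * (y * yⁿ)) * ([ m ] * (e * p))) a-index ⟩
    (y * (y * yⁿ)) * ([ α ℕ.+ suc (suc n) ] * (e * p)) ∎
    where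
    a b d e yⁿ p : Carrier
    a = [ suc n ℕ.+ α ℕ.+ 1 ]
    b = [ suc n ]
    d = [ suc n ℕ.+ α ]
    e = [ α ℕ.+ suc n ]
    yⁿ = pow R y n
    p = shiftedFactorial α n
    d-index : suc n ℕ.+ α ≡ α ℕ.+ suc n
    d-index = ℕP.+-comm (suc n) α
    a-index : suc n ℕ.+ α ℕ.+ 1 ≡ α ℕ.+ suc (suc n)
    a-index = trans (ℕP.+-comm (suc n ℕ.+ α) 1) (trans (cong suc d-index) (sym (ℕP.+-suc α (suc n))))

  laguerre-at-zero : (n : ℕ) → LagBar R α 0# y q n ≈ pow R y n * shiftedFactorial α n
  laguerre-at-zero n = proj₁ (consecutive n)
    where
    consecutive : (n : ℕ) → (M n ≈ pow R y n * shiftedFactorial α n)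
                          × (M (suc n) ≈ pow R y (suc n) * shiftedFactorial α (suc n))
    consecutive zero = ≈-refl , M-one
    consecutive (suc n) with consecutive n
    ... | h₀ , h₁ = h₁ , closed-form-step n h₀ h₁

toList-tabulate : {n : ℕ} (f : Fin n → A) → Vec.toList (Vec.tabulate f) ≡ List.tabulate f
toList-tabulate {n = zero} f = refl
toList-tabulate {n = suc n} f = cong (f Fin.zero ∷_) (toList-tabulate (λ i → f (Fin.suc i)))

toList-lookup : {n : ℕ} (v : Vec A n) → Vec.toList v ≡ map (lookup v) (allFin n)
toList-lookup v = trans (cong Vec.toList (sym (VP.tabulate∘lookup v)))
                        (trans (toList-tabulate (lookup v)) (sym (LP.map-tabulate (λ i → i) (lookup v))))

vec-ext : {n : ℕ} {v v' : Vec A n} → (∀ i → lookup v i ≡ lookup v' i) → v ≡ v'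
vec-ext {v = v} {v'} h = trans (sym (VP.tabulate∘lookup v)) (trans (VP.tabulate-cong h) (VP.tabulate∘lookup v'))

sum-tabulate-length : {k : ℕ} (g : Fin k → List A) →
  Vec.sum (Vec.tabulate (λ i → length (g i))) ≡ length (concatMap g (allFin k))
sum-tabulate-length {k = zero} g = refl
sum-tabulate-length {k = suc k} g = begin
  length (g Fin.zero) ℕ.+ Vec.sum (Vec.tabulate (λ i → length (g (Fin.suc i))))
    ≡⟨ cong (length (g Fin.zero) ℕ.+_) (sum-tabulate-length (λ i → g (Fin.suc i))) ⟩
  length (g Fin.zero) ℕ.+ length (concatMap (λ i → g (Fin.suc i)) (allFin k))
    ≡⟨ sym (LP.length-++ (g Fin.zero)) ⟩
  length (g Fin.zero ++ concatMap (λ i → g (Fin.suc i)) (allFin k))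
    ≡⟨ cong (λ gs → length (concat gs)) (sym (map-allFin-suc g)) ⟩
  length (concatMap g (allFin (suc k))) ∎
  where open ≡-Reasoning

perm-injective : {n : ℕ} {σ : Vec (Fin n) n} → IsPerm σ → ∀ {i j} → lookup σ i ≡ lookup σ j → i ≡ j
perm-injective {σ = σ} isPerm =
  unique-map⇒injective (subst Unique (toList-lookup σ) isPerm) (MP.∈-allFin _) (MP.∈-allFin _)

∈-allVecs : {m n : ℕ} (v : Vec (Fin m) n) → v ∈ allVecs (allFin m) n
∈-allVecs [] = here refl
∈-allVecs (x ∷ v) = MP.∈-cartesianProductWith⁺ Vec._∷_ (MP.∈-allFin x) (∈-allVecs v)

allVecs-unique : {xs : List A} (n : ℕ) → Unique xs → Unique (allVecs xs n)
allVecs-unique zero u = [] ∷ []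
allVecs-unique (suc n) u = UP.cartesianProductWith⁺ Vec._∷_ (λ { refl → refl , refl }) u (allVecs-unique n u)

module ColPermsList (α n : ℕ) where

  ∈-colPerms⁺ : {σ : Vec (Fin n) n} {c : Vec (Fin (suc α)) n} →
    IsPerm σ → IsCycleColouring α σ c → (σ , c) ∈ colPerms α n
  ∈-colPerms⁺ {σ} {c} isPerm cycles =
    ∈-concatMap⁺ (MP.∈-filter⁺ isPerm? (∈-allVecs σ) isPerm)
                 (MP.∈-map⁺ (σ ,_) (MP.∈-filter⁺ (isCycleColouring? α σ) (∈-allVecs c) cycles))

  ∈-colPerms⁻ : {σ : Vec (Fin n) n} {c : Vec (Fin (suc α)) n} →
    (σ , c) ∈ colPerms α n → IsPerm σ × IsCycleColouring α σ c
  ∈-colPerms⁻ {σ} p∈ with ∈-concatMap⁻ (perms n) p∈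
  ... | σ' , σ'∈ , p∈' with MP.∈-map⁻ (σ' ,_) p∈'
  ... | c' , c'∈ , refl =
    proj₂ (MP.∈-filter⁻ isPerm? {xs = allVecs (allFin n) n} σ'∈) ,
    proj₂ (MP.∈-filter⁻ (isCycleColouring? α σ) {xs = allVecs (allFin (suc α)) n} c'∈)

  colPerms-unique : Unique (colPerms α n)
  colPerms-unique =
    concatMap-unique proj₁ (UP.filter⁺ isPerm? (allVecs-unique n (UP.allFin⁺ n)))
      (λ σ → UP.map⁺ (λ { refl → refl })
               (UP.filter⁺ (isCycleColouring? α σ) (allVecs-unique n (UP.allFin⁺ (suc α)))))
      first≡
    where
    first≡ : ∀ {σ p} → p ∈ map (σ ,_) (filter (isCycleColouring? α σ) (allVecs (allFin (suc α)) n)) → proj₁ p ≡ σ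
    first≡ {σ} p∈ with MP.∈-map⁻ (σ ,_) p∈
    ... | c , _ , refl = refl

-- 0^{m₀} 1^{m₁} ⋯ α^{m_α}: the colours of the positions listed block by block
colourWord : {α : ℕ} → Vec ℕ (suc α) → List (Fin (suc α))
colourWord {α} m = concatMap (λ k → replicate (lookup m k) k) (allFin (suc α))

colourWord-length : {α : ℕ} (m : Vec ℕ (suc α)) → length (colourWord m) ≡ Vec.sum m
colourWord-length m =
  trans (sym (sum-tabulate-length (λ k → replicate (lookup m k) k)))
        (cong Vec.sum (trans (VP.tabulate-cong (λ k → LP.length-replicate (lookup m k) {k})) (VP.tabulate∘lookup m)))

colourWord-cons : {α : ℕ} (j : ℕ) (m : Vec ℕ (suc α)) →
  colourWord (j ∷ m) ≡ replicate j Fin.zero ++ map Fin.suc (colourWord m)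
colourWord-cons {α} j m = begin
  concat (map segment (allFin (suc (suc α))))
    ≡⟨ cong concat (map-allFin-suc segment) ⟩
  replicate j Fin.zero ++ concatMap (λ k → replicate (lookup m k) (Fin.suc k)) (allFin (suc α))
    ≡⟨ cong (λ ks → replicate j Fin.zero ++ concat ks)
            (trans (LP.map-cong (λ k → sym (LP.map-replicate Fin.suc (lookup m k) k)) (allFin (suc α)))
                   (LP.map-∘ (allFin (suc α)))) ⟩
  replicate j Fin.zero ++ concat (map (map Fin.suc) (map (λ k → replicate (lookup m k) k) (allFin (suc α))))
    ≡⟨ cong (replicate j Fin.zero ++_) (LP.concat-map (map (λ k → replicate (lookup m k) k) (allFin (suc α)))) ⟩
  replicate j Fin.zero ++ map Fin.suc (colourWord m) ∎
  where
  open ≡-Reasoning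
  segment : Fin (suc (suc α)) → List (Fin (suc (suc α)))
  segment k = replicate (lookup (j ∷ m) k) k

module FinOccurrences {m : ℕ} where
  open DecidableLists (FP._≟_ {suc m})

  zeros-at-zero : (j : ℕ) → occurrences Fin.zero (replicate j Fin.zero) ≡ j
  zeros-at-zero zero = refl
  zeros-at-zero (suc j) = cong suc (zeros-at-zero j)

  zeros-at-suc : (k : Fin m) (j : ℕ) → occurrences (Fin.suc k) (replicate j Fin.zero) ≡ 0
  zeros-at-suc k zero = refl
  zeros-at-suc k (suc j) = zeros-at-suc k j

  shifted-at-zero : (xs : List (Fin m)) → occurrences Fin.zero (map Fin.suc xs) ≡ 0
  shifted-at-zero [] = refl
  shifted-at-zero (x ∷ xs) = shifted-at-zero xs

  shifted-at-suc : (k : Fin m) (xs : List (Fin m)) →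
    occurrences (Fin.suc k) (map Fin.suc xs) ≡ DecidableLists.occurrences FP._≟_ k xs
  shifted-at-suc k [] = refl
  shifted-at-suc k (x ∷ xs) with x FP.≟ k
  ... | yes refl = cong suc (shifted-at-suc k xs)
  ... | no _ = shifted-at-suc k xs

occurrences-colourWord : {α : ℕ} (m : Vec ℕ (suc α)) (k : Fin (suc α)) →
  DecidableLists.occurrences FP._≟_ k (colourWord m) ≡ lookup m k
occurrences-colourWord {zero} (j ∷ []) Fin.zero =
  trans (occurrences-++ Fin.zero (replicate j Fin.zero) []) (trans (ℕP.+-identityʳ _) (zeros-at-zero j))
  where
  open DecidableLists (FP._≟_ {1})
  open FinOccurrences {0}
occurrences-colourWord {suc α} (j ∷ m) k =
  trans (cong (occurrences k) (colourWord-cons j m))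
        (trans (occurrences-++ k (replicate j Fin.zero) _) (split k))
  where
  open DecidableLists (FP._≟_ {suc (suc α)})
  open FinOccurrences {suc α}
  split : (k : Fin (suc (suc α))) →
    occurrences k (replicate j Fin.zero) ℕ.+ occurrences k (map Fin.suc (colourWord m)) ≡ lookup (j ∷ m) k
  split Fin.zero = trans (cong₂ ℕ._+_ (zeros-at-zero j) (shifted-at-zero (colourWord m))) (ℕP.+-identityʳ j)
  split (Fin.suc k) = trans (cong₂ ℕ._+_ (zeros-at-suc k j) (shifted-at-suc k (colourWord m))) (occurrences-colourWord m k)

module Blocks {α n : ℕ} (c : Vec (Fin (suc α)) n) where
  open DecidableLists (FP._≟_ {n})

  positions : List (Fin n)
  positions = concatMap (block c) (allFin (suc α))

  ∈-positions : (a : Fin n) → a ∈ positions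
  ∈-positions a = ∈-concatMap⁺ (MP.∈-allFin (lookup c a))
                    (MP.∈-filter⁺ (λ i → lookup c i FP.≟ lookup c a) (MP.∈-allFin a) refl)

  positions-unique : Unique positions
  positions-unique = concatMap-unique (lookup c) (UP.allFin⁺ (suc α))
    (λ k → UP.filter⁺ (λ i → lookup c i FP.≟ k) (UP.allFin⁺ n))
    (λ {k} a∈ → proj₂ (MP.∈-filter⁻ (λ i → lookup c i FP.≟ k) {xs = allFin n} a∈))

  positions-length : length positions ≡ n
  positions-length = ℕP.≤-antisym
    (subst (length positions ≤_) (LP.length-tabulate (λ i → i)) (pigeonhole positions-unique (λ {a} _ → MP.∈-allFin a)))
    (subst (_≤ length positions) (LP.length-tabulate (λ i → i)) (pigeonhole (UP.allFin⁺ n) (λ {a} _ → ∈-positions a)))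

  blockSizes : Vec ℕ (suc α)
  blockSizes = Vec.tabulate (λ k → length (block c k))

  blockSizes-sum : Vec.sum blockSizes ≡ n
  blockSizes-sum = trans (sum-tabulate-length (block c)) positions-length

  colours-of-positions : map (lookup c) positions ≡ colourWord blockSizes
  colours-of-positions = begin
    map (lookup c) (concat (map (block c) (allFin (suc α))))
      ≡⟨ sym (LP.concat-map (map (block c) (allFin (suc α)))) ⟩
    concat (map (map (lookup c)) (map (block c) (allFin (suc α))))
      ≡⟨ cong concat (sym (LP.map-∘ (allFin (suc α)))) ⟩
    concatMap (λ k → map (lookup c) (block c k)) (allFin (suc α))
      ≡⟨ cong concat (LP.map-cong constant-on-block (allFin (suc α))) ⟩
    colourWord blockSizes ∎
    where
    open ≡-Reasoning
    constant-on-block : (k : Fin (suc α)) → map (lookup c) (block c k) ≡ replicate (lookup blockSizes k) k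
    constant-on-block k =
      trans (DecidableLists.map-filter-const FP._≟_ (lookup c) k (allFin n))
            (cong (λ j → replicate j k) (sym (VP.lookup∘tabulate (λ k′ → length (block c k′)) k)))

underσ-positions : {α n : ℕ} (σ : Vec (Fin n) n) (c : Vec (Fin (suc α)) n) →
  underσ σ c ≡ map toℕ (map (lookup σ) (Blocks.positions c))
underσ-positions {α} σ c = begin
  concat (map (λ k → map (λ i → toℕ (lookup σ i)) (block c k)) (allFin (suc α)))
    ≡⟨ cong concat (LP.map-∘ (allFin (suc α))) ⟩
  concat (map (map (λ i → toℕ (lookup σ i))) (map (block c) (allFin (suc α))))
    ≡⟨ LP.concat-map (map (block c) (allFin (suc α))) ⟩
  map (λ i → toℕ (lookup σ i)) (Blocks.positions c)
    ≡⟨ LP.map-∘ (Blocks.positions c) ⟩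
  map toℕ (map (lookup σ) (Blocks.positions c)) ∎
  where open ≡-Reasoning

underunderσ-blockSizes : {α n : ℕ} (c : Vec (Fin (suc α)) n) → underunderσ {α} c ≡ zeroOneWord (Blocks.blockSizes c)
underunderσ-blockSizes {α} c = cong (λ ks → replicate (length (block c Fin.zero)) 0 ++ concat ks)
  (LP.map-cong (λ k → cong (λ j → 1 ∷ replicate j 0) (sym (VP.lookup∘tabulate (λ k → length (block c k)) (Fin.suc k)))) (allFin α))

module Encoding (α n : ℕ) where
  open ColPermsList α n
  open Blocks using (positions; ∈-positions; positions-unique; positions-length; blockSizes)

  word : Vec (Fin n) n → Vec (Fin (suc α)) n → List (Fin n)
  word σ c = map (lookup σ) (positions c)

  encode : Vec (Fin n) n × Vec (Fin (suc α)) n → List (Fin n) × Vec ℕ (suc α)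
  encode (σ , c) = word σ c , blockSizes c

  codes : List (List (Fin n) × Vec ℕ (suc α))
  codes = cartesianProduct (arrangements n) (compositions α n)

  word-unique : {σ : Vec (Fin n) n} (c : Vec (Fin (suc α)) n) → IsPerm σ → Unique (word σ c)
  word-unique c isPerm = map-unique (positions-unique c) (λ _ _ → perm-injective isPerm)

  word-length : (σ : Vec (Fin n) n) (c : Vec (Fin (suc α)) n) → length (word σ c) ≡ n
  word-length σ c = trans (LP.length-map (lookup σ) (positions c)) (positions-length c)

  -- σ preserves colours, so the letters of σ̲ carry the colours of the positions
  colours-of-word : {σ : Vec (Fin n) n} {c : Vec (Fin (suc α)) n} → IsCycleColouring α σ c →
    map (lookup c) (word σ c) ≡ colourWord (blockSizes c)
  colours-of-word {σ} {c} cycles =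
    trans (sym (LP.map-∘ (positions c)))
          (trans (map-cong-∈ (λ {a} _ → All.lookup cycles (MP.∈-allFin a))) (Blocks.colours-of-positions c))

  encode-∈ : ∀ {p} → p ∈ colPerms α n → encode p ∈ codes
  encode-∈ {σ , c} p∈ with ∈-colPerms⁻ p∈
  ... | isPerm , _ = MP.∈-cartesianProduct⁺ (∈-arrangements⁺ (word-length σ c) (word-unique c isPerm))
                                             (∈-compositions⁺ α n (blockSizes c) (Blocks.blockSizes-sum c))

  -- the word and the block sizes determine first c (through the colours of
  -- the letters, which exhaust {0,…,n-1}) and then σ
  encode-injective : ∀ {p p'} → p ∈ colPerms α n → p' ∈ colPerms α n → encode p ≡ encode p' → p ≡ p'
  encode-injective {σ , c} {σ' , c'} p∈ p'∈ e with ∈-colPerms⁻ p∈ | ∈-colPerms⁻ p'∈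
  ... | isPerm , cycles | _ , cycles' = same-perm c≡c' (cong proj₁ e)
    where
    colours≡ : map (lookup c) (word σ c) ≡ map (lookup c') (word σ c)
    colours≡ = trans (colours-of-word {σ} {c} cycles)
                 (trans (cong colourWord (cong proj₂ e))
                   (trans (sym (colours-of-word {σ'} {c'} cycles')) (cong (map (lookup c')) (sym (cong proj₁ e)))))
    c≡c' : c ≡ c'
    c≡c' = vec-ext λ a → map-≡⇒pointwise colours≡
             (arrangement-complete (word-unique c isPerm) (word-length σ c) a)
    same-perm : c ≡ c' → word σ c ≡ word σ' c' → (σ , c) ≡ (σ' , c')
    same-perm refl w≡ = cong (_, c) (vec-ext λ a → map-≡⇒pointwise w≡ (∈-positions c a))

  module Decode {w : List (Fin n)} {m : Vec ℕ (suc α)} (w∈ : w ∈ arrangements n) (m∈ : m ∈ compositions α n) where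
    open DecidableLists (FP._≟_ {n})

    w-length : length w ≡ n
    w-length = proj₁ (∈-arrangements⁻ w∈)

    w-unique : Unique w
    w-unique = proj₂ (∈-arrangements⁻ w∈)

    -- the i-th letter of w gets the i-th colour of the colour word of m
    colour : Vec (Fin (suc α)) n
    colour = Vec.tabulate (λ a → assoc (zip w (colourWord m)) a Fin.zero)

    colours-of-w : map (lookup colour) w ≡ colourWord m
    colours-of-w =
      trans (map-cong-∈ (λ {a} _ → VP.lookup∘tabulate _ a))
            (assoc-zip (λ _ → Fin.zero) w-unique
                       (trans w-length (sym (trans (colourWord-length m) (∈-compositions⁻ α n m∈)))))

    blockSizes-colour : blockSizes colour ≡ m
    blockSizes-colour = vec-ext λ k → begin
      lookup (blockSizes colour) k
        ≡⟨ VP.lookup∘tabulate (λ k → length (block colour k)) k ⟩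
      length (filter (λ i → lookup colour i FP.≟ k) (allFin n))
        ≡⟨ sym (PermP.↭-length (PermP.filter-↭ (λ i → lookup colour i FP.≟ k) w↭allFin)) ⟩
      length (filter (λ i → lookup colour i FP.≟ k) w)
        ≡⟨ DecidableLists.occurrences-map FP._≟_ (lookup colour) k w ⟩
      DecidableLists.occurrences FP._≟_ k (map (lookup colour) w)
        ≡⟨ cong (DecidableLists.occurrences FP._≟_ k) colours-of-w ⟩
      DecidableLists.occurrences FP._≟_ k (colourWord m)
        ≡⟨ occurrences-colourWord m k ⟩
      lookup m k ∎
      where
      open ≡-Reasoning
      w↭allFin : w ↭ allFin n
      w↭allFin = ∼bag⇒↭ (unique∧set⇒bag w-unique (UP.allFin⁺ n)
                   (λ {a} → mk⇔ (λ _ → MP.∈-allFin a) (λ _ → arrangement-complete w-unique w-length a)))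

    -- σ sends the positions, block by block, to the letters of w
    perm : Vec (Fin n) n
    perm = Vec.tabulate (λ a → assoc (zip (positions colour) w) a a)

    positions≡w : length (positions colour) ≡ length w
    positions≡w = trans (positions-length colour) (sym w-length)

    word-perm : word perm colour ≡ w
    word-perm = trans (map-cong-∈ (λ {a} _ → VP.lookup∘tabulate _ a))
                      (assoc-zip (λ a → a) (positions-unique colour) positions≡w)

    perm-isPerm : IsPerm perm
    perm-isPerm = subst Unique (sym (toList-tabulate _))
      (UP.tabulate⁺ (λ {i} {j} → assoc-injective i j (positions-unique colour) w-unique positions≡w
                                   (∈-positions colour i) (∈-positions colour j)))

    perm-cycles : IsCycleColouring α perm colour
    perm-cycles = All.tabulate (λ {i} _ → map-≡⇒pointwise colours-along (∈-positions colour i))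
      where
      colours-along : map (λ a → lookup colour (lookup perm a)) (positions colour) ≡ map (lookup colour) (positions colour)
      colours-along =
        trans (LP.map-∘ (positions colour))
          (trans (cong (map (lookup colour)) word-perm)
            (trans colours-of-w
              (trans (cong colourWord (sym blockSizes-colour)) (sym (Blocks.colours-of-positions colour)))))

  encode-onto : ∀ {code} → code ∈ codes → ∃ λ p → p ∈ colPerms α n × encode p ≡ code
  encode-onto {w , m} code∈ with MP.∈-cartesianProduct⁻ (arrangements n) (compositions α n) code∈
  ... | w∈ , m∈ = (perm , colour) , ∈-colPerms⁺ perm-isPerm perm-cycles , cong₂ _,_ word-perm blockSizes-colour
    where open Decode w∈ m∈

-- The weight of (σ , c) is y^n q^{inv σ̲} · q^{inv σ̲̲}, a product of a
-- function of the word and a function of the block sizes.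
module Weights {c ℓ : Level} (R : CommutativeRing c ℓ) (α n : ℕ) (y q : CommutativeRing.Carrier R) where
  open CommutativeRing R
    renaming (refl to ≈-refl; sym to ≈-sym; trans to ≈-trans; reflexive to ≈-reflexive)
    hiding (zero)
  open RingSums R
  open Encoding α n
  open import Relation.Binary.Reasoning.Setoid setoid

  weight : Vec (Fin n) n × Vec (Fin (suc α)) n → Carrier
  weight (σ , c) = pow R y (length (underσ σ c)) * pow R q (inv (underσ σ c) ℕ.+ inv (underunderσ {α} c))

  wordWeight : List (Fin n) → Carrier
  wordWeight w = pow R y n * pow R q (inv (map toℕ w))

  compositionWeight : Vec ℕ (suc α) → Carrier
  compositionWeight m = pow R q (inv (zeroOneWord m))

  codeWeight : List (Fin n) × Vec ℕ (suc α) → Carrier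
  codeWeight (w , m) = wordWeight w * compositionWeight m

  weight-encode : (σ : Vec (Fin n) n) (c : Vec (Fin (suc α)) n) → weight (σ , c) ≈ codeWeight (encode (σ , c))
  weight-encode σ c = begin
    pow R y (length (underσ σ c)) * pow R q (inv (underσ σ c) ℕ.+ inv (underunderσ {α} c))
      ≡⟨ cong₂ (λ u v → pow R y (length u) * pow R q (inv u ℕ.+ inv v)) (underσ-positions σ c) (underunderσ-blockSizes c) ⟩
    pow R y (length (map toℕ w)) * pow R q (inv (map toℕ w) ℕ.+ inv u)
      ≡⟨ cong (λ k → pow R y k * pow R q (inv (map toℕ w) ℕ.+ inv u)) (trans (LP.length-map toℕ w) (word-length σ c)) ⟩
    pow R y n * pow R q (inv (map toℕ w) ℕ.+ inv u)
      ≈⟨ *-congˡ (pow-+ q (inv (map toℕ w)) (inv u)) ⟩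
    pow R y n * (pow R q (inv (map toℕ w)) * pow R q (inv u))
      ≈⟨ ≈-sym (*-assoc _ _ _) ⟩
    codeWeight (encode (σ , c)) ∎
    where
    w : List (Fin n)
    w = word σ c
    u : List ℕ
    u = zeroOneWord (Blocks.blockSizes c)

-- The theorem: comparing coefficients of t^n/n!_q,
--   Σ_{σ ∈ 𝒮^{(α)}[n]} y^{|σ̲|} q^{inv σ̲ + inv σ̲̲} = L̄^{(α)}_n(0;y|q).
lemma1 : {c ℓ : Level} (R : CommutativeRing c ℓ) (α : ℕ) → 1 ≤ α →
    (y q : CommutativeRing.Carrier R) (n : ℕ) →
    CommutativeRing._≈_ R (colPermSum R α y q n) (LagBar R α (CommutativeRing.0# R) y q n)
lemma1 R α _ y q n = begin
  colPermSum R α y q n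
    ≈⟨ sum-bijection (colPerms α n) codes encode weight codeWeight colPerms-unique
         (UP.cartesianProduct⁺ (arrangements-unique n) (compositions-unique α n))
         encode-injective encode-∈ encode-onto (λ {p} _ → weight-encode (proj₁ p) (proj₂ p)) ⟩
  Σ (map codeWeight codes)
    ≈⟨ sum-cartesianProduct wordWeight compositionWeight (arrangements n) (compositions α n) ⟩
  Σ (map wordWeight (arrangements n)) * compositionSum α n
    ≈⟨ *-congʳ (sum-scale (pow R y n) (λ w → pow R q (inv (map toℕ w))) (arrangements n)) ⟩
  (pow R y n * invSum n) * compositionSum α n
    ≈⟨ *-assoc _ _ _ ⟩
  pow R y n * (invSum n * compositionSum α n)
    ≈⟨ *-congˡ (≈-trans (*-congʳ (mahonian n)) (qfactorial-compositionSum α n)) ⟩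
  pow R y n * shiftedFactorial α n
    ≈⟨ ≈-sym (laguerre-at-zero n) ⟩
  LagBar R α 0# y q n ∎
  where
  open CommutativeRing R renaming (sym to ≈-sym; trans to ≈-trans) hiding (zero)
  open RingSums R
  open ColPermsList α n
  open Encoding α n
  open Weights R α n y q
  open Mahonian R q
  open QIntegers R q
  open CompositionSum R q
  open LaguerreAtZero R α y q
  open import Relation.Binary.Reasoning.Setoid setoid
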